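{- Let $E=\mathbb{Q}(\sqrt{ -d})$ be an imaginary quadratic field ($d$ a square-free positive integer) with ring of integers $\mathcal{O}=\mathbb{Z}+\mathbb{Z}\omega$. Let $\mathfrak{U}=\mathcal{O}k+\mathcal{O}(s+t\omega)$ be an integral ideal with $k\in\mathbb{Z}_{>0}$, $s,t\in\mathbb{Z}$ and $\mathfrak{U}\overline{\mathfrak{U}}=k\mathcal{O}$, and let $m_d$ be the smallest positive integer $m$ such that every positive integer is a sum of $m$ norms of elements of $\mathcal{O}$. Then for every positive integer $r\equiv0\pmod k$ there exist $\gamma_\ell=a_\ell+b_\ell\omega\in\mathcal{O}$ ($a_\ell,b_\ell\in\mathbb{Z}$, $1\leq\ell\leq m_d$) such that: if $d\equiv1,2\pmod4$ then $k\mid(sa_\ell-dtb_\ell)$ and $k\mid(ta_\ell+sb_\ell)$ for all $\ell$; if $d\equiv3\pmod4$ then $k\mid\big(sa_\ell-\frac{1+d}{4}tb_\ell\big)$ and $k\mid(ta_\ell+(s+t)b_\ell)$ for all $\ell$; and $r/k=\sum_{\ell=1}^{m_d}N(\gamma_\ell/k)$.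
   Context: $\omega=\sqrt{ -d}$ if $d\equiv1,2\pmod 4$ and $\omega=(1+\sqrt{ -d})/2$ if $d\equiv3\pmod4$; $N(\alpha)=\alpha\overline{\alpha}$. -}

module Defs where

open import Data.Nat as ℕ using (ℕ; _%_; _/_; _<_)
open import Data.Nat.Divisibility as ℕD using ()
open import Data.Integer as ℤ using (ℤ; +_; _+_; _*_; _-_; -_)
open import Data.Product using (_×_; _,_; proj₁; Σ; ∃)
open import Data.List using (List; []; _∷_; map; concatMap)
open import Data.Vec using (Vec; foldr)
open import Relation.Binary.PropositionalEquality using (_≡_)

SquareFree : ℕ → Set
SquareFree n = ∀ p → (p ℕ.* p) ℕD.∣ n → p ≡ 1

-- Elements a + bω of O, represented by the pair (a , b).
O : Set
O = ℤ × ℤ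

-- ω² = trω d · ω − nω d   (trω = ω + ω̄, nω = ω ω̄)
-- d ≡ 1,2 (mod 4): ω = √-d, ω² = -d.
-- d ≡ 3 (mod 4): ω = (1+√-d)/2, ω² = ω − (1+d)/4.
trω : ℕ → ℤ
trω d with d % 4
... | 3 = + 1
... | _ = + 0

nω : ℕ → ℤ
nω d with d % 4
... | 3 = + ((1 ℕ.+ d) / 4)
... | _ = + d

addO : O → O → O
addO (a , b) (c , e) = (a + c , b + e)

mulO : ℕ → O → O → O
mulO d (a , b) (c , e) = (a * c - nω d * (b * e) , a * e + b * c + trω d * (b * e))

-- complex conjugation: conj(a + bω) = a + b ω̄ = (a + trω·b) − bω
conjO : ℕ → O → O
conjO d (a , b) = (a + trω d * b , - b)

-- N(α) = α ᾱ  (a rational integer; we take its ℤ-coordinate)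
normO : ℕ → O → ℤ
normO d α = proj₁ (mulO d α (conjO d α))

ι : ℤ → O
ι n = (n , + 0)

InSpan : ℕ → List O → O → Set
InSpan d [] α = α ≡ ι (+ 0)
InSpan d (g ∷ gs) α = Σ O λ x → Σ O λ β → InSpan d gs β × α ≡ addO (mulO d x g) β

idealMul : ℕ → List O → List O → List O
idealMul d gs hs = concatMap (λ g → map (mulO d g) hs) gs

idealConj : ℕ → List O → List O
idealConj d gs = map (conjO d) gs

SameIdeal : ℕ → List O → List O → Set
SameIdeal d gs hs = ∀ α → (InSpan d gs α → InSpan d hs α) × (InSpan d hs α → InSpan d gs α)

sumNorms : ℕ → ∀ {m} → Vec O m → ℤ
sumNorms d = foldr _ (λ γ acc → normO d γ + acc) (+ 0)

SumOfNorms : ℕ → ℕ → ℕ → Set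
SumOfNorms d m n = Σ (Vec O m) λ γ → sumNorms d γ ≡ + n

IsMd : ℕ → ℕ → Set
IsMd d m = (0 < m) × (∀ n → 0 < n → SumOfNorms d m n)
         × (∀ m' → 0 < m' → (∀ n → 0 < n → SumOfNorms d m' n) → m ℕ.≤ m')

-- Write r = q k.  Since q is a positive integer it is a sum of m_d norms N(β_ℓ), and
-- γ_ℓ = k β_ℓ works: both coordinates of γ_ℓ are multiples of k, so every ℤ-linear
-- condition on them holds, and Σ N(γ_ℓ) = k² Σ N(β_ℓ) = k² q = k r.
module Submission where

open import Defs
open import Data.Nat as ℕ using (ℕ; _%_; _/_; _<_)
open import Data.Nat.Divisibility as ℕD using ()
open import Data.Integer as ℤ using (ℤ; +_; _+_; _*_; _-_; -_)
open import Data.Integer.Divisibility as ℤD using ()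
open import Data.Integer.Divisibility.Signed as Signed using (∣⇒∣ᵤ)
open import Data.Integer.Properties using (*-zeroʳ; *-distribˡ-+; pos-*)
open import Data.Integer.Tactic.RingSolver using (solve-∀)
open import Data.Product using (_×_; _,_; Σ)
open import Data.Sum using (_⊎_)
open import Data.List using ([]; _∷_)
open import Data.Vec using (Vec; []; _∷_; map)
open import Data.Vec.Relation.Unary.All as All using (All)
open import Data.Vec.Relation.Unary.All.Properties using (map⁺)
open import Relation.Binary.PropositionalEquality using (_≡_; refl; sym; cong; cong₂; module ≡-Reasoning)
open ≡-Reasoning

scale : ℤ → O → O
scale c (a , b) = (c * a , c * b)

normO-scale : ∀ d c α → normO d (scale c α) ≡ c * c * normO d α
normO-scale d c (a , b) = identity c a b (nω d) (trω d)
  where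
  identity : ∀ c a b n τ →
             c * a * (c * a + τ * (c * b)) - n * (c * b * - (c * b))
             ≡ c * c * (a * (a + τ * b) - n * (b * - b))
  identity = solve-∀

sumNorms-map-scale : ∀ d c {m} (β : Vec O m) →
                     sumNorms d (map (scale c) β) ≡ c * c * sumNorms d β
sumNorms-map-scale d c []      = sym (*-zeroʳ (c * c))
sumNorms-map-scale d c (α ∷ β) = begin
  normO d (scale c α) + sumNorms d (map (scale c) β)
    ≡⟨ cong₂ _+_ (normO-scale d c α) (sumNorms-map-scale d c β) ⟩
  c * c * normO d α + c * c * sumNorms d β
    ≡⟨ *-distribˡ-+ (c * c) (normO d α) (sumNorms d β) ⟨
  c * c * (normO d α + sumNorms d β) ∎

∣-scale : ∀ c x → c Signed.∣ c * x
∣-scale c x = Signed.∣m⇒∣m*n x Signed.∣-refl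

All-map-scale : ∀ {P : O → Set} c →
                (∀ {a b} → c Signed.∣ a → c Signed.∣ b → P (a , b)) →
                ∀ {m} (β : Vec O m) → All P (map (scale c) β)
All-map-scale c multiples⇒P β =
  map⁺ (All.universal (λ { (a , b) → multiples⇒P (∣-scale c a) (∣-scale c b) }) β)

∣-combination⁺ : ∀ {c a b} u v → c Signed.∣ a → c Signed.∣ b → c ℤD.∣ u * a + v * b
∣-combination⁺ u v c∣a c∣b =
  ∣⇒∣ᵤ (Signed.∣m∣n⇒∣m+n (Signed.∣n⇒∣m*n u c∣a) (Signed.∣n⇒∣m*n v c∣b))

∣-combination⁻ : ∀ {c a b} u v → c Signed.∣ a → c Signed.∣ b → c ℤD.∣ u * a - v * b
∣-combination⁻ u v c∣a c∣b =
  ∣⇒∣ᵤ (Signed.∣m∣n⇒∣m-n (Signed.∣n⇒∣m*n u c∣a) (Signed.∣n⇒∣m*n v c∣b))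

lemma3 : (d : ℕ) → 0 < d → SquareFree d →
    (k : ℕ) → 0 < k → (s t : ℤ) →
    SameIdeal d (idealMul d (ι (+ k) ∷ (s , t) ∷ []) (idealConj d (ι (+ k) ∷ (s , t) ∷ []))) (ι (+ k) ∷ []) →
    (m : ℕ) → IsMd d m →
    (r : ℕ) → 0 < r → k ℕD.∣ r →
    Σ (Vec O m) λ γ →
    All (λ { (a , b) →
    (d % 4 ≡ 1 ⊎ d % 4 ≡ 2 →
    (+ k ℤD.∣ (s * a - + d * t * b)) × (+ k ℤD.∣ (t * a + s * b)))
    × (d % 4 ≡ 3 →
    (+ k ℤD.∣ (s * a - + ((1 ℕ.+ d) / 4) * t * b)) × (+ k ℤD.∣ (t * a + (s + t) * b))) }) γ
    × sumNorms d γ ≡ + k * + r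
lemma3 _ _ _ _ _ _ _ _ _ _ _ () (ℕD.divides ℕ.zero refl)
lemma3 d _ _ k _ s t _ m (_ , sumsOfNorms , _) _ _ (ℕD.divides q@(ℕ.suc _) refl)
  with β , ∑Nβ≡q ← sumsOfNorms q (ℕ.s≤s ℕ.z≤n) =
  map (scale (+ k)) β ,
  All-map-scale (+ k) (λ k∣a k∣b →
    (λ _ → ∣-combination⁻ s (+ d * t) k∣a k∣b , ∣-combination⁺ t s k∣a k∣b) ,
    (λ _ → ∣-combination⁻ s (+ ((1 ℕ.+ d) / 4) * t) k∣a k∣b , ∣-combination⁺ t (s + t) k∣a k∣b)) β ,
  ∑Nkβ≡kr
  where
  rearrange : ∀ x y → x * x * y ≡ x * (y * x)
  rearrange = solve-∀

  ∑Nkβ≡kr : sumNorms d (map (scale (+ k)) β) ≡ + k * + (q ℕ.* k)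
  ∑Nkβ≡kr = begin
    sumNorms d (map (scale (+ k)) β) ≡⟨ sumNorms-map-scale d (+ k) β ⟩
    + k * + k * sumNorms d β         ≡⟨ cong (+ k * + k *_) ∑Nβ≡q ⟩
    + k * + k * + q                  ≡⟨ rearrange (+ k) (+ q) ⟩
    + k * (+ q * + k)                ≡⟨ cong (+ k *_) (pos-* q k) ⟨
    + k * + (q ℕ.* k)                ∎
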